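{- Let $L$ be a multiset of integers greater than $2$ and let $m\ge 0$. If there is a graceful labeling $\Gamma$ of $[L,2\mid m]_\epsilon$ such that $\epsilon\in\Delta_p\Gamma$ (the path of $\Gamma$ contains an edge with difference $\epsilon$), then there is a $[\underline{2m+7},4,{}^2L]$-starter (over $\mathbb{Z}_{2n}$ for some $n$), i.e. a $2$-starter whose cycle through $\infty$ has length $2m+7$ and whose other cycles are one $4$-cycle and two $\ell$-cycles for each $\ell\in L$ (counted with multiplicity).
   Context: Notation: $\mathcal{I}(a,b)=\{x\in\mathbb{Z}\mid a\le x\le b\}$. For a multiset $L$ of integers $\ge 2$ and $m\ge 0$, $[L\mid m]$ is the vertex-disjoint union of one $\ell$-cycle for each $\ell\in L$ (with multiplicity; a $2$-cycle consists of two vertices joined by two parallel edges) and a path with $m$ edges; $[L,2\mid m]$ means $L$ with one extra $2$ added, and the subscript in $[L\mid m]_\epsilon$ denotes its number of edges $\epsilon=\sum_{\ell\in L}\ell+m$. A labeling of such a graph is an isomorphic copy whose vertices are distinct integers. For a graph $\Gamma$ with integer vertices, $\Delta\Gamma$ is the multiset of all differences $x-y$ over ordered pairs $(x,y)$ of adjacent vertices (each edge, including parallel ones, contributes both $\pm$ its difference), and $\Delta_p\Gamma$ is the corresponding multiset for the edges of the path component. A graceful labeling of $[L\mid m]_\epsilon$ (which contains at most one $2$-cycle) is a labeling $\Gamma$ with vertex set $\mathcal{I}(0,\epsilon)$ such that $\Delta\Gamma=\pm\mathcal{I}(1,\epsilon)$ if there is no $2$-cycle, and $\Delta\Gamma=\pm\{1,3,3\}\cup\pm\mathcal{I}(4,\epsilon)$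 (as multisets) if there is exactly one $2$-cycle. For graphs with vertices in $\mathbb{Z}_{2n}\cup\{\infty\}$, $\Delta$ is computed in $\mathbb{Z}_{2n}$ ignoring edges at $\infty$, and $\Sigma+n$ translates every vertex except $\infty$ by $n$. A $2$-starter over $\mathbb{Z}_{2n}$ is a $2$-regular graph $\Sigma$ with vertex set $\mathbb{Z}_{2n}\cup\{\infty\}$ such that $\Delta\Sigma\supseteq\mathbb{Z}_{2n}\setminus\{0\}$ and $\Sigma+n=\Sigma$. -}

module Defs where

open import Data.Nat as ℕ using (ℕ; zero; suc; _∸_; _<_; _≤_; _%_)
open import Data.Nat.DivMod using (m%n<n)
open import Data.Integer as ℤ using (ℤ; +_; -_)
open import Data.Fin as Fin using (Fin; toℕ; fromℕ<)
open import Data.Product using (Σ; ∃; ∃-syntax; _×_; _,_)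
open import Data.Sum using (_⊎_)
open import Data.List using (List; []; _∷_; _++_; map; concat; concatMap; length; upTo; allFin)
open import Data.Nat.ListAction using (sum)
open import Data.List.Relation.Unary.All using (All)
open import Data.List.Relation.Unary.Unique.Propositional using (Unique)
open import Data.List.Relation.Binary.Permutation.Propositional using (_↭_)
open import Data.List.Membership.Propositional using (_∈_; _∉_)
open import Relation.Binary.PropositionalEquality using (_≡_; _≢_)

pathEdges : ∀ {A : Set} → List A → List (A × A)
pathEdges (x ∷ y ∷ xs) = (x , y) ∷ pathEdges (y ∷ xs)
pathEdges _            = []

-- edges of a cycle (x0 x1 ... x_{l-1}): consecutive pairs plus (x_{l-1}, x0).
-- For l = 2 this yields the two parallel edges of a 2-cycle.
cycleEdges : ∀ {A : Set} → List A → List (A × A)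
cycleEdges []       = []
cycleEdges (x ∷ xs) = pathEdges (x ∷ xs ++ x ∷ [])

bothDirs : ∀ {A : Set} → List (A × A) → List (A × A)
bothDirs = concatMap (λ { (x , y) → (x , y) ∷ (y , x) ∷ [] })

Δℤ : List (ℤ × ℤ) → List ℤ
Δℤ = concatMap (λ { (x , y) → (x ℤ.- y) ∷ (y ℤ.- x) ∷ [] })

pm : List ℤ → List ℤ
pm = concatMap (λ d → d ∷ (- d) ∷ [])

I : ℕ → ℕ → List ℤ
I a b = map (λ i → + (a ℕ.+ i)) (upTo (suc b ∸ a))

record Labeling (L : List ℕ) (m : ℕ) : Set where
  field
    cycles   : List (List ℤ)
    path     : List ℤ
    cycleLen : map length cycles ↭ L
    pathLen  : length path ≡ suc m
    distinct : Unique (concat cycles ++ path)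
open Labeling public

vertices : ∀ {L m} → Labeling L m → List ℤ
vertices Γ = concat (cycles Γ) ++ path Γ

edges : ∀ {L m} → Labeling L m → List (ℤ × ℤ)
edges Γ = concatMap cycleEdges (cycles Γ) ++ pathEdges (path Γ)

ΔΓ : ∀ {L m} → Labeling L m → List ℤ
ΔΓ Γ = Δℤ (edges Γ)

Δp : ∀ {L m} → Labeling L m → List ℤ
Δp Γ = Δℤ (pathEdges (path Γ))

edgeCount : List ℕ → ℕ → ℕ
edgeCount L m = sum L ℕ.+ m

-- graceful labeling of [L | m]_ε (at most one 2-cycle)
Graceful : (L : List ℕ) (m : ℕ) → Labeling L m → Set
Graceful L m Γ =
  (vertices Γ ↭ I 0 ε) ×
  ( (2 ∉ L × ΔΓ Γ ↭ pm (I 1 ε))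
  ⊎ (2 ∈ L × ΔΓ Γ ↭ (pm (+ 1 ∷ + 3 ∷ + 3 ∷ []) ++ pm (I 4 ε))) )
  where ε = edgeCount L m

data V (n : ℕ) : Set where
  ∞   : V n
  fin : Fin (2 ℕ.* n) → V n

allV : (n : ℕ) → List (V n)
allV n = ∞ ∷ map fin (allFin (2 ℕ.* n))

_-ₘ_ : ∀ {k} → Fin k → Fin k → Fin k
_-ₘ_ {suc k} x y = fromℕ< (m%n<n (toℕ x ℕ.+ (suc k ∸ toℕ y)) (suc k))

_+ℕₘ_ : ∀ {k} → Fin k → ℕ → Fin k
_+ℕₘ_ {suc k} x a = fromℕ< (m%n<n (toℕ x ℕ.+ a) (suc k))

-- A 2-regular graph on vertex set Z_{2n} ∪ {∞}, given by its cycles.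
CycleGraph : ℕ → Set
CycleGraph n = List (List (V n))

graphEdges : ∀ {n} → CycleGraph n → List (V n × V n)
graphEdges = concatMap cycleEdges

ΔZ : ∀ {n} → CycleGraph n → List (Fin (2 ℕ.* n))
ΔZ Σ' = concatMap f (graphEdges Σ')
  where
  f : _ → List _
  f (fin x , fin y) = (x -ₘ y) ∷ (y -ₘ x) ∷ []
  f _                 = []

shift : ∀ {n} → CycleGraph n → CycleGraph n
shift {n} = map (map sh)
  where
  sh : V n → V n
  sh ∞       = ∞
  sh (fin x) = fin (x +ℕₘ n)

Is2Starter : (n : ℕ) → CycleGraph n → Set
Is2Starter n Σ' =
  All (λ c → 2 ≤ length c) Σ' ×
  (concat Σ' ↭ allV n) ×                               -- vertex set Z_{2n} ∪ {∞}, components disjoint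
  (∀ (z : Fin (2 ℕ.* n)) → toℕ z ≢ 0 → z ∈ ΔZ Σ') ×
  (bothDirs (graphEdges (shift Σ')) ↭ bothDirs (graphEdges Σ'))

HasType : ∀ {n} → CycleGraph n → ℕ → List ℕ → Set
HasType {n} Σ' k K =
  ∃[ C ] ∃[ rest ] (Σ' ↭ C ∷ rest) × (∞ ∈ C) × (length C ≡ k) × (map length rest ↭ K)

module Submission where

-- A graceful labeling of [L, 2 | m]_ε realises each of ±1, ±4, …, ±ε once and ±3 twice; the 2-cycle realises its
-- difference twice, so it is (u, u + 3), and the path edge of difference ε joins 0 and ε, so the path reads A, 0, ε, B.
-- With n = ε + 3 the starter over ℤ_2n consists of the ∞-cycle ∞, H, reverse H′, where H = A, 0, ε + 1 + n, ε + 2,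
-- (ε, B) + n and H′ ≡ H + n (mod 2n), of the 4-cycle (u, u + 3, u + n, u + 3 + n), and of each remaining cycle c
-- together with c + n. Translation by n swaps H and H′, rotates the 4-cycle and swaps c with c + n. Every difference
-- j ≤ n lies on an edge: the labeling's own edges other than 0 — ε survive (those of ε, B translated by n), ε lies on
-- the 4-cycle, 2, ε + 1 and ε + 2 on the edges replacing 0 — ε, and n where the ∞-cycle turns from H to H′.

open import Defs
open import Data.Nat as ℕ using (ℕ; zero; suc; _<_; _≤_; _+_; _*_; _∸_; _%_; z≤n; s≤s)
open import Data.Nat.Properties
open import Data.Nat.DivMod using (m%n<n; [m+n]%n≡m%n; %-distribˡ-+; m%n%n≡m%n; m<n⇒m%n≡m)
open import Data.Integer as ℤ using (ℤ; +_; -_; ∣_∣)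
import Data.Integer.Properties as ℤₚ
open import Data.Fin using (Fin; toℕ; fromℕ<)
open import Data.Fin.Properties using (toℕ-fromℕ<; toℕ-injective; toℕ<n)
open import Data.Product as Prod using (∃; ∃₂; ∃-syntax; _×_; _,_; proj₁; proj₂; swap)
open import Data.Product.Properties using (,-injectiveˡ; ,-injectiveʳ)
open import Data.Sum as Sum using (_⊎_; inj₁; inj₂)
open import Data.Empty using (⊥-elim)
open import Function using (_∘_; _∘′_)
open import Data.List
  using (List; []; _∷_; _++_; [_]; _∷ʳ_; map; concat; concatMap; reverse; length; filter; upTo; applyUpTo; tabulate; allFin)
open import Data.List.Properties
  using (++-assoc; map-++; map-∘; map-id; map-cong; concat-++; concat-map; concatMap-++; reverse-++; reverse-map;
         reverse-involutive; unfold-reverse; length-++; length-map; length-reverse; ∷-injectiveˡ;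
         filter-accept; filter-reject; filter-none; map-upTo; map-applyUpTo; applyUpTo-∷ʳ; map-tabulate; tabulate-cong)
open import Data.List.Membership.Propositional using (_∈_; find; lose)
open import Data.List.Membership.Propositional.Properties
  using (∈-++⁺ˡ; ∈-++⁺ʳ; ∈-++⁻; ∈-map⁺; ∈-map⁻; ∈-concat⁺′; ∈-concatMap⁺; ∈-concatMap⁻; ∈-upTo⁻; ∈-applyUpTo⁺; ∈-∃++)
open import Data.List.Relation.Unary.Any using (here; there)
open import Data.List.Relation.Unary.All as All using (All; []; _∷_)
import Data.List.Relation.Unary.All.Properties as Allₚ
open import Data.List.Relation.Unary.AllPairs using (AllPairs; []; _∷_)
import Data.List.Relation.Unary.AllPairs.Properties as AllPairsₚ
open import Data.List.Relation.Binary.Permutation.Propositional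
  using (_↭_; ↭-refl; ↭-sym; ↭-trans; ↭-prep; ↭-swap; ↭-reflexive; module PermutationReasoning)
open import Data.List.Relation.Binary.Permutation.Propositional.Properties as ↭ₚ
  using (++⁺ˡ; ++⁺ʳ; ++⁺; ++-comm; shifts; drop-∷; ↭-reverse; map⁺; ∈-resp-↭; All-resp-↭; ↭-length; filter-↭)
  renaming (shift to ↭-shift)
open import Relation.Nullary using (¬_; Dec; yes; no)
open import Relation.Binary.PropositionalEquality
  using (_≡_; _≢_; refl; sym; trans; cong; cong₂; subst; subst₂; module ≡-Reasoning)

private variable A B : Set

-- Paths and cycles as lists of vertices

concat⁺ : {xss yss : List (List A)} → xss ↭ yss → concat xss ↭ concat yss
concat⁺ _↭_.refl           = ↭-refl
concat⁺ (_↭_.prep xs p)    = ++⁺ˡ xs (concat⁺ p)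
concat⁺ (_↭_.swap xs ys p) = ↭-trans (++⁺ˡ xs (++⁺ˡ ys (concat⁺ p))) (shifts xs ys)
concat⁺ (_↭_.trans p q)    = ↭-trans (concat⁺ p) (concat⁺ q)

concatMap⁺ : (f : A → List B) {xs ys : List A} → xs ↭ ys → concatMap f xs ↭ concatMap f ys
concatMap⁺ f p = concat⁺ (map⁺ f p)

∈-concatMap⁺′ : {f : A → List B} {x : A} {xs : List A} {y : B} → x ∈ xs → y ∈ f x → y ∈ concatMap f xs
∈-concatMap⁺′ {f = f} x∈xs y∈fx = ∈-concatMap⁺ f (lose x∈xs y∈fx)

∈-concatMap⁻′ : (f : A → List B) {xs : List A} {y : B} → y ∈ concatMap f xs → ∃ λ x → x ∈ xs × y ∈ f x
∈-concatMap⁻′ f p = find (∈-concatMap⁻ f p)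

map-length-map : ∀ (f : A → B) cs → map length (map (map f) cs) ≡ map length cs
map-length-map f cs = trans (sym (map-∘ cs)) (map-cong (length-map f) cs)

∃-snoc : ∀ (x : A) xs → ∃₂ λ ys y → x ∷ xs ≡ ys ++ [ y ]
∃-snoc x []        = [] , x , refl
∃-snoc x (x′ ∷ xs) = let ys , y , eq = ∃-snoc x′ xs in x ∷ ys , y , cong (x ∷_) eq

applyUpTo≡tabulate : ∀ {A : Set} (f : ℕ → A) n → applyUpTo f n ≡ tabulate {n = n} (f ∘ toℕ)
applyUpTo≡tabulate f zero    = refl
applyUpTo≡tabulate f (suc n) = cong (f 0 ∷_) (applyUpTo≡tabulate (f ∘ suc) n)

applyUpTo-+ : ∀ {A : Set} (f : ℕ → A) a b → applyUpTo f (a + b) ≡ applyUpTo f a ++ applyUpTo (f ∘ (a ℕ.+_)) b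
applyUpTo-+ f zero    b = refl
applyUpTo-+ f (suc a) b = cong (f 0 ∷_) (applyUpTo-+ (f ∘ suc) a b)

upTo-+ : ∀ a b → upTo (a + b) ≡ upTo a ++ map (_+ a) (upTo b)
upTo-+ a b = begin
  upTo (a + b)                        ≡⟨ applyUpTo-+ (λ i → i) a b ⟩
  upTo a ++ applyUpTo (a ℕ.+_) b        ≡⟨ cong (upTo a ++_) (map-upTo (a ℕ.+_) b) ⟨
  upTo a ++ map (a ℕ.+_) (upTo b)       ≡⟨ cong (upTo a ++_) (map-cong (+-comm a) (upTo b)) ⟩
  upTo a ++ map (_+ a) (upTo b)       ∎
  where
  open ≡-Reasoning

pathEdges-++ : ∀ (xs : List A) y ys → pathEdges (xs ++ y ∷ ys) ≡ pathEdges (xs ++ [ y ]) ++ pathEdges (y ∷ ys)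
pathEdges-++ []            y ys = refl
pathEdges-++ (x ∷ [])      y ys = refl
pathEdges-++ (x ∷ x′ ∷ xs) y ys = cong ((x , x′) ∷_) (pathEdges-++ (x′ ∷ xs) y ys)

pathEdges-map : ∀ (f : A → B) xs → pathEdges (map f xs) ≡ map (Prod.map f f) (pathEdges xs)
pathEdges-map f []           = refl
pathEdges-map f (x ∷ [])     = refl
pathEdges-map f (x ∷ y ∷ xs) = cong ((f x , f y) ∷_) (pathEdges-map f (y ∷ xs))

cycleEdges-map : ∀ (f : A → B) xs → cycleEdges (map f xs) ≡ map (Prod.map f f) (cycleEdges xs)
cycleEdges-map f []       = refl
cycleEdges-map f (x ∷ xs) = begin
  pathEdges (f x ∷ map f xs ++ [ f x ])  ≡⟨ cong (λ ys → pathEdges (f x ∷ ys)) (map-++ f xs [ x ]) ⟨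
  pathEdges (map f (x ∷ xs ++ [ x ]))    ≡⟨ pathEdges-map f (x ∷ xs ++ [ x ]) ⟩
  map (Prod.map f f) (cycleEdges (x ∷ xs)) ∎
  where open ≡-Reasoning

concatMap-cycleEdges-map : ∀ (f : A → B) cs → map (Prod.map f f) (concatMap cycleEdges cs) ≡ concatMap cycleEdges (map (map f) cs)
concatMap-cycleEdges-map f []       = refl
concatMap-cycleEdges-map f (c ∷ cs) = trans (map-++ (Prod.map f f) (cycleEdges c) _)
  (cong₂ _++_ (sym (cycleEdges-map f c)) (concatMap-cycleEdges-map f cs))

pathEdges-reverse : ∀ (xs : List A) → pathEdges (reverse xs) ≡ reverse (map swap (pathEdges xs))
pathEdges-reverse []           = refl
pathEdges-reverse (x ∷ [])     = refl
pathEdges-reverse (x ∷ y ∷ xs) = begin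
  pathEdges (reverse (x ∷ y ∷ xs))                        ≡⟨ cong pathEdges reverse-split ⟩
  pathEdges (reverse xs ++ y ∷ x ∷ [])                    ≡⟨ pathEdges-++ (reverse xs) y [ x ] ⟩
  pathEdges (reverse xs ++ [ y ]) ++ [ (y , x) ]          ≡⟨ cong (λ zs → pathEdges zs ++ [ (y , x) ]) (unfold-reverse y xs) ⟨
  pathEdges (reverse (y ∷ xs)) ++ [ (y , x) ]             ≡⟨ cong (_++ [ (y , x) ]) (pathEdges-reverse (y ∷ xs)) ⟩
  reverse (map swap (pathEdges (y ∷ xs))) ++ [ (y , x) ]  ≡⟨ unfold-reverse (y , x) (map swap (pathEdges (y ∷ xs))) ⟨
  reverse (map swap (pathEdges (x ∷ y ∷ xs)))             ∎
  where
  open ≡-Reasoning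
  reverse-split : reverse (x ∷ y ∷ xs) ≡ reverse xs ++ y ∷ x ∷ []
  reverse-split = reverse-++ (x ∷ y ∷ []) xs

∈-pathEdges-middle : ∀ (xs : List A) a b ys → (a , b) ∈ pathEdges (xs ++ a ∷ b ∷ ys)
∈-pathEdges-middle []            a b ys = here refl
∈-pathEdges-middle (x ∷ [])      a b ys = there (here refl)
∈-pathEdges-middle (x ∷ x′ ∷ xs) a b ys = there (∈-pathEdges-middle (x′ ∷ xs) a b ys)

∈-pathEdges-++⁺ˡ : ∀ {e : A × A} xs ys → e ∈ pathEdges xs → e ∈ pathEdges (xs ++ ys)
∈-pathEdges-++⁺ˡ (x ∷ y ∷ xs) ys (here p)  = here p
∈-pathEdges-++⁺ˡ (x ∷ y ∷ xs) ys (there p) = there (∈-pathEdges-++⁺ˡ (y ∷ xs) ys p)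

∈-pathEdges-++⁺ʳ : ∀ {e : A × A} xs ys → e ∈ pathEdges ys → e ∈ pathEdges (xs ++ ys)
∈-pathEdges-++⁺ʳ []            ys       p = p
∈-pathEdges-++⁺ʳ (x ∷ [])      (y ∷ ys) p = there p
∈-pathEdges-++⁺ʳ (x ∷ x′ ∷ xs) ys       p = there (∈-pathEdges-++⁺ʳ (x′ ∷ xs) ys p)

∈-pathEdges-turn : ∀ (xs ys : List A) x y → (x , y) ∈ pathEdges ((xs ++ [ x ]) ++ reverse (ys ++ [ y ]))
∈-pathEdges-turn xs ys x y = subst (λ zs → (x , y) ∈ pathEdges zs) (sym turn) (∈-pathEdges-middle xs x y (reverse ys))
  where
  turn : (xs ++ [ x ]) ++ reverse (ys ++ [ y ]) ≡ xs ++ x ∷ y ∷ reverse ys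
  turn = trans (cong ((xs ++ [ x ]) ++_) (reverse-++ ys [ y ])) (++-assoc xs [ x ] (y ∷ reverse ys))

∈-pathEdges⁻ : ∀ {x y : A} xs → (x , y) ∈ pathEdges xs → ∃₂ λ P Q → xs ≡ P ++ x ∷ y ∷ Q
∈-pathEdges⁻ (a ∷ b ∷ xs) (here refl) = [] , xs , refl
∈-pathEdges⁻ (a ∷ b ∷ xs) (there p)   =
  let P , Q , eq = ∈-pathEdges⁻ (b ∷ xs) p in a ∷ P , Q , cong (a ∷_) eq

∈-pathEdges-split : ∀ {e : A × A} P x y Q → e ∈ pathEdges (P ++ x ∷ y ∷ Q) →
  e ∈ pathEdges (P ++ [ x ]) ⊎ e ≡ (x , y) ⊎ e ∈ pathEdges (y ∷ Q)
∈-pathEdges-split P x y Q p rewrite pathEdges-++ P x (y ∷ Q) with ∈-++⁻ (pathEdges (P ++ [ x ])) p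
... | inj₁ q         = inj₁ q
... | inj₂ (here q)  = inj₂ (inj₁ q)
... | inj₂ (there q) = inj₂ (inj₂ q)

∈-pathEdges-reverse : ∀ {e : A × A} xs → e ∈ pathEdges xs → swap e ∈ pathEdges (reverse xs)
∈-pathEdges-reverse xs p rewrite pathEdges-reverse xs = ∈-resp-↭ (↭-sym (↭-reverse _)) (∈-map⁺ swap p)

∈-pathEdges-map : ∀ (f : A → B) {e} xs → e ∈ pathEdges xs → Prod.map f f e ∈ pathEdges (map f xs)
∈-pathEdges-map f xs p rewrite pathEdges-map f xs = ∈-map⁺ (Prod.map f f) p

∈-cycleEdges-map : ∀ (f : A → B) {e} xs → e ∈ cycleEdges xs → Prod.map f f e ∈ cycleEdges (map f xs)
∈-cycleEdges-map f xs p rewrite cycleEdges-map f xs = ∈-map⁺ (Prod.map f f) p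

∈-pathEdges-endpoints : ∀ {x y : A} xs → (x , y) ∈ pathEdges xs → x ∈ xs × y ∈ xs
∈-pathEdges-endpoints (a ∷ b ∷ xs) (here refl) = here refl , there (here refl)
∈-pathEdges-endpoints (a ∷ b ∷ xs) (there p)   = Prod.map there there (∈-pathEdges-endpoints (b ∷ xs) p)

∈-cycleEdges-endpoints : ∀ {x y : A} xs → (x , y) ∈ cycleEdges xs → x ∈ xs × y ∈ xs
∈-cycleEdges-endpoints (a ∷ xs) p = Prod.map closing closing (∈-pathEdges-endpoints (a ∷ xs ++ [ a ]) p)
  where
  closing : ∀ {z} → z ∈ a ∷ xs ++ [ a ] → z ∈ a ∷ xs
  closing (here e) = here e
  closing (there q) with ∈-++⁻ xs q
  ... | inj₁ s        = there s
  ... | inj₂ (here e) = here e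

∈-edges-endpoints : ∀ {x y : A} cs P → (x , y) ∈ concatMap cycleEdges cs ++ pathEdges P →
  x ∈ concat cs ++ P × y ∈ concat cs ++ P
∈-edges-endpoints cs P e with ∈-++⁻ (concatMap cycleEdges cs) e
... | inj₁ e∈cycles = let c , c∈cs , e∈c = ∈-concatMap⁻′ cycleEdges e∈cycles in
  Prod.map (in-vertices c∈cs) (in-vertices c∈cs) (∈-cycleEdges-endpoints c e∈c)
  where
  in-vertices : ∀ {c z} → c ∈ cs → z ∈ c → z ∈ concat cs ++ P
  in-vertices c∈cs z∈c = ∈-++⁺ˡ (∈-concat⁺′ z∈c c∈cs)
... | inj₂ e∈path   = Prod.map (∈-++⁺ʳ (concat cs)) (∈-++⁺ʳ (concat cs)) (∈-pathEdges-endpoints P e∈path)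

bothDirs-↭ : {xs ys : List (A × A)} → xs ↭ ys → bothDirs xs ↭ bothDirs ys
bothDirs-↭ = concatMap⁺ _

bothDirs-++⁺ : ∀ (xs xs′ ys ys′ : List (A × A)) → bothDirs xs ↭ bothDirs xs′ → bothDirs ys ↭ bothDirs ys′ →
  bothDirs (xs ++ ys) ↭ bothDirs (xs′ ++ ys′)
bothDirs-++⁺ xs xs′ ys ys′ p q = begin
  bothDirs (xs ++ ys)            ≡⟨ concatMap-++ _ xs ys ⟩
  bothDirs xs ++ bothDirs ys     ↭⟨ ++⁺ p q ⟩
  bothDirs xs′ ++ bothDirs ys′   ≡⟨ concatMap-++ _ xs′ ys′ ⟨
  bothDirs (xs′ ++ ys′)          ∎
  where open PermutationReasoning

bothDirs-swap : ∀ (xs : List (A × A)) → bothDirs (map swap xs) ↭ bothDirs xs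
bothDirs-swap []             = ↭-refl
bothDirs-swap ((x , y) ∷ xs) = ↭-swap (y , x) (x , y) (bothDirs-swap xs)

cycleEdges-reverse : ∀ (x : A) ys → bothDirs (cycleEdges (x ∷ reverse ys)) ↭ bothDirs (cycleEdges (x ∷ ys))
cycleEdges-reverse x ys = begin
  bothDirs (pathEdges (x ∷ reverse ys ++ [ x ]))          ≡⟨ cong (bothDirs ∘′ pathEdges) closed-reverse ⟩
  bothDirs (pathEdges (reverse (x ∷ ys ++ [ x ])))        ≡⟨ cong bothDirs (pathEdges-reverse (x ∷ ys ++ [ x ])) ⟩
  bothDirs (reverse (map swap (cycleEdges (x ∷ ys))))     ↭⟨ bothDirs-↭ (↭-reverse (map swap (cycleEdges (x ∷ ys)))) ⟩
  bothDirs (map swap (cycleEdges (x ∷ ys)))               ↭⟨ bothDirs-swap (cycleEdges (x ∷ ys)) ⟩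
  bothDirs (cycleEdges (x ∷ ys))                          ∎
  where
  open PermutationReasoning
  closed-reverse : x ∷ reverse ys ++ [ x ] ≡ reverse (x ∷ ys ++ [ x ])
  closed-reverse = sym (trans (unfold-reverse x (ys ++ [ x ])) (cong (_++ [ x ]) (reverse-++ ys [ x ])))

cycleEdges-flip : ∀ (x : A) P Q → bothDirs (cycleEdges (x ∷ P ++ reverse Q)) ↭ bothDirs (cycleEdges (x ∷ Q ++ reverse P))
cycleEdges-flip x P Q = subst (λ R → bothDirs (cycleEdges (x ∷ R)) ↭ bothDirs (cycleEdges (x ∷ Q ++ reverse P)))
  (sym flip≡) (cycleEdges-reverse x (Q ++ reverse P))
  where
  flip≡ : P ++ reverse Q ≡ reverse (Q ++ reverse P)
  flip≡ = sym (trans (reverse-++ Q (reverse P)) (cong (_++ reverse Q) (reverse-involutive P)))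

cycleEdges-rotate : ∀ (a b c d : A) → cycleEdges (c ∷ d ∷ a ∷ b ∷ []) ↭ cycleEdges (a ∷ b ∷ c ∷ d ∷ [])
cycleEdges-rotate a b c d = ++-comm ((c , d) ∷ (d , a) ∷ []) ((a , b) ∷ (b , c) ∷ [])

concatMap-cycleEdges-comm : ∀ (X Y : List (List A)) → concatMap cycleEdges (X ++ Y) ↭ concatMap cycleEdges (Y ++ X)
concatMap-cycleEdges-comm X Y = ↭-trans (↭-reflexive (concatMap-++ cycleEdges X Y))
  (↭-trans (++-comm (concatMap cycleEdges X) _) (↭-reflexive (sym (concatMap-++ cycleEdges Y X))))

Adjacent : List (A × A) → A → A → Set
Adjacent es a b = (a , b) ∈ es ⊎ (b , a) ∈ es

HasDifference : List (ℕ × ℕ) → ℕ → Set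
HasDifference es k = ∃₂ λ a b → a ≡ b + k × Adjacent es a b

Adjacent-resp-↭ : ∀ {es es′ : List (A × A)} → es ↭ es′ → ∀ {a b} → Adjacent es a b → Adjacent es′ a b
Adjacent-resp-↭ p = Sum.map (∈-resp-↭ p) (∈-resp-↭ p)

Adjacent-++⁺ʳ : ∀ (xs : List (A × A)) {ys ys′} → (∀ {a b} → Adjacent ys a b → Adjacent ys′ a b) →
  ∀ {a b} → Adjacent (xs ++ ys) a b → Adjacent (xs ++ ys′) a b
Adjacent-++⁺ʳ xs f (inj₁ e) with ∈-++⁻ xs e
... | inj₁ e∈xs = inj₁ (∈-++⁺ˡ e∈xs)
... | inj₂ e∈ys = Sum.map (∈-++⁺ʳ xs) (∈-++⁺ʳ xs) (f (inj₁ e∈ys))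
Adjacent-++⁺ʳ xs f (inj₂ e) with ∈-++⁻ xs e
... | inj₁ e∈xs = inj₂ (∈-++⁺ˡ e∈xs)
... | inj₂ e∈ys = Sum.map (∈-++⁺ʳ xs) (∈-++⁺ʳ xs) (f (inj₂ e∈ys))

Adjacent-reverse : ∀ xs {a b : A} → Adjacent (pathEdges xs) a b → Adjacent (pathEdges (reverse xs)) a b
Adjacent-reverse xs = Sum.swap ∘ Sum.map (∈-pathEdges-reverse xs) (∈-pathEdges-reverse xs)

HasDifference-map : ∀ {es es′ k} → (∀ {a b} → Adjacent es a b → Adjacent es′ a b) → HasDifference es k → HasDifference es′ k
HasDifference-map f (a , b , a≡b+k , adj) = a , b , a≡b+k , f adj

∃-orientation : ∀ xs {a b : A} → Adjacent (pathEdges xs) a b →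
  ∃₂ λ F B → F ++ a ∷ b ∷ B ≡ xs ⊎ F ++ a ∷ b ∷ B ≡ reverse xs
∃-orientation xs {a} {b} (inj₁ e) = let F , B , eq = ∈-pathEdges⁻ xs e in F , B , inj₁ (sym eq)
∃-orientation xs {a} {b} (inj₂ e) = let P , Q , eq = ∈-pathEdges⁻ xs e in
  reverse Q , reverse P , inj₂ (trans (reversed P Q) (cong reverse (sym eq)))
  where
  reversed : ∀ P Q → reverse Q ++ a ∷ b ∷ reverse P ≡ reverse (P ++ b ∷ a ∷ Q)
  reversed P Q = sym (begin
    reverse (P ++ b ∷ a ∷ Q)                 ≡⟨ reverse-++ P (b ∷ a ∷ Q) ⟩
    reverse (b ∷ a ∷ Q) ++ reverse P         ≡⟨ cong (_++ reverse P) (reverse-++ (b ∷ a ∷ []) Q) ⟩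
    (reverse Q ++ a ∷ b ∷ []) ++ reverse P   ≡⟨ ++-assoc (reverse Q) (a ∷ b ∷ []) (reverse P) ⟩
    reverse Q ++ a ∷ b ∷ reverse P           ∎)
    where open ≡-Reasoning

path-or-reverse : ∀ {xs ys : List A} → ys ≡ xs ⊎ ys ≡ reverse xs →
  ys ↭ xs × length ys ≡ length xs × (∀ {a b} → Adjacent (pathEdges xs) a b → Adjacent (pathEdges ys) a b)
path-or-reverse (inj₁ refl)          = ↭-refl , refl , λ adj → adj
path-or-reverse {xs = xs} (inj₂ refl) = ↭-reverse xs , length-reverse xs , Adjacent-reverse xs

-- Residues modulo 2n

-- n is passed as suc k so that 2 * n reduces to a successor, as _-ₘ_ and _+ℕₘ_ require.
module Residues (k : ℕ) where

  n : ℕ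
  n = suc k

  2n : ℕ
  2n = 2 * n

  2n≡n+n : 2n ≡ n + n
  2n≡n+n = cong (n ℕ.+_) (+-identityʳ n)

  residue : ℕ → Fin 2n
  residue a = fromℕ< (m%n<n a 2n)

  vertex : ℕ → V n
  vertex a = fin (residue a)

  translate : V n → V n
  translate ∞       = ∞
  translate (fin x) = fin (x +ℕₘ n)

  -- Defs.shift translates by a local function that cannot be named here, hence the detour through single cycles.
  shift-single : ∀ (c : List (V n)) → shift (c ∷ []) ≡ map translate c ∷ []
  shift-single []          = refl
  shift-single (∞ ∷ c)     = cong (map (∞ ∷_)) (shift-single c)
  shift-single (fin x ∷ c) = cong (map (fin (x +ℕₘ n) ∷_)) (shift-single c)

  shift≡map-translate : ∀ (Σ′ : CycleGraph n) → shift Σ′ ≡ map (map translate) Σ′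
  shift≡map-translate []       = refl
  shift≡map-translate (c ∷ Σ′) = cong₂ _∷_ (∷-injectiveˡ (shift-single c)) (shift≡map-translate Σ′)

  toℕ-residue : ∀ a → toℕ (residue a) ≡ a % 2n
  toℕ-residue a = toℕ-fromℕ< (m%n<n a 2n)

  toℕ-residue-< : ∀ {a} → a < 2n → toℕ (residue a) ≡ a
  toℕ-residue-< {a} a<2n = trans (toℕ-residue a) (m<n⇒m%n≡m a<2n)

  map-vertex-upTo : map vertex (upTo 2n) ≡ map fin (allFin 2n)
  map-vertex-upTo = begin
    map vertex (upTo 2n)        ≡⟨ map-upTo vertex 2n ⟩
    applyUpTo vertex 2n         ≡⟨ applyUpTo≡tabulate vertex 2n ⟩
    tabulate (vertex ∘ toℕ)     ≡⟨ tabulate-cong (λ i → cong fin (toℕ-injective (toℕ-residue-< (toℕ<n i)))) ⟩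
    tabulate fin                ≡⟨ map-tabulate (λ i → i) fin ⟨
    map fin (allFin 2n)         ∎
    where open ≡-Reasoning

  vertex-cong : ∀ {a b} → a % 2n ≡ b % 2n → vertex a ≡ vertex b
  vertex-cong {a} {b} eq = cong fin (toℕ-injective (trans (toℕ-residue a) (trans eq (sym (toℕ-residue b)))))

  translate-vertex : ∀ a → translate (vertex a) ≡ vertex (a + n)
  translate-vertex a = cong fin (toℕ-injective (begin
    toℕ (residue a +ℕₘ n)             ≡⟨ toℕ-fromℕ< (m%n<n (toℕ (residue a) + n) 2n) ⟩
    (toℕ (residue a) + n) % 2n        ≡⟨ cong (λ r → (r + n) % 2n) (toℕ-residue a) ⟩
    (a % 2n + n) % 2n                 ≡⟨ %-distribˡ-+ (a % 2n) n 2n ⟩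
    (a % 2n % 2n + n % 2n) % 2n       ≡⟨ cong (λ r → (r + n % 2n) % 2n) (m%n%n≡m%n a 2n) ⟩
    (a % 2n + n % 2n) % 2n            ≡⟨ %-distribˡ-+ a n 2n ⟨
    (a + n) % 2n                      ≡⟨ toℕ-residue (a + n) ⟨
    toℕ (residue (a + n))             ∎))
    where open ≡-Reasoning

  vertex-+n+n : ∀ a → vertex (a + n + n) ≡ vertex a
  vertex-+n+n a = vertex-cong {a + n + n} {a} (trans (cong (_% 2n) (trans (+-assoc a n n) (cong (a ℕ.+_) (sym 2n≡n+n)))) ([m+n]%n≡m%n a 2n))

  toℕ-residue-minus : ∀ {a b j} → a < 2n → b < 2n → a ≡ b + j → toℕ (residue a -ₘ residue b) ≡ j
  toℕ-residue-minus {a} {b} {j} a<2n b<2n a≡b+j = begin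
    toℕ (residue a -ₘ residue b)                          ≡⟨ toℕ-fromℕ< (m%n<n (toℕ (residue a) + (2n ∸ toℕ (residue b))) 2n) ⟩
    (toℕ (residue a) + (2n ∸ toℕ (residue b))) % 2n       ≡⟨ cong₂ (λ x y → (x + (2n ∸ y)) % 2n) (toℕ-residue-< a<2n) (toℕ-residue-< b<2n) ⟩
    (a + (2n ∸ b)) % 2n                                   ≡⟨ cong (λ x → (x + (2n ∸ b)) % 2n) (trans a≡b+j (+-comm b j)) ⟩
    (j + b + (2n ∸ b)) % 2n                               ≡⟨ cong (_% 2n) (trans (+-assoc j b _) (cong (j ℕ.+_) (m+[n∸m]≡n (<⇒≤ b<2n)))) ⟩
    (j + 2n) % 2n                                         ≡⟨ [m+n]%n≡m%n j 2n ⟩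
    j % 2n                                                ≡⟨ m<n⇒m%n≡m j<2n ⟩
    j                                                     ∎
    where
    open ≡-Reasoning
    j<2n : j < 2n
    j<2n = ≤-<-trans (subst (j ≤_) (sym (trans a≡b+j (+-comm b j))) (m≤m+n j b)) a<2n

  toℕ-residue-minus′ : ∀ {a b j} → 0 < j → a < 2n → b < 2n → a ≡ b + j → toℕ (residue b -ₘ residue a) ≡ 2n ∸ j
  toℕ-residue-minus′ {a} {b} {j} 0<j a<2n b<2n a≡b+j = begin
    toℕ (residue b -ₘ residue a)                          ≡⟨ toℕ-fromℕ< (m%n<n (toℕ (residue b) + (2n ∸ toℕ (residue a))) 2n) ⟩
    (toℕ (residue b) + (2n ∸ toℕ (residue a))) % 2n       ≡⟨ cong₂ (λ x y → (x + (2n ∸ y)) % 2n) (toℕ-residue-< b<2n) (toℕ-residue-< a<2n) ⟩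
    (b + (2n ∸ a)) % 2n                                   ≡⟨ cong (λ x → (b + (2n ∸ x)) % 2n) (trans a≡b+j (+-comm b j)) ⟩
    (b + (2n ∸ (j + b))) % 2n                             ≡⟨ cong (λ x → (b + x) % 2n) (∸-+-assoc 2n j b) ⟨
    (b + (2n ∸ j ∸ b)) % 2n                               ≡⟨ cong (_% 2n) (m+[n∸m]≡n b≤2n∸j) ⟩
    (2n ∸ j) % 2n                                         ≡⟨ m<n⇒m%n≡m (∸-monoʳ-< 0<j j≤2n) ⟩
    2n ∸ j                                                ∎
    where
    open ≡-Reasoning
    j+b<2n : j + b < 2n
    j+b<2n = subst (_< 2n) (trans a≡b+j (+-comm b j)) a<2n
    b≤2n∸j : b ≤ 2n ∸ j
    b≤2n∸j = m+n≤o⇒m≤o∸n b (subst (_≤ 2n) (+-comm j b) (<⇒≤ j+b<2n))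
    j≤2n : j ≤ 2n
    j≤2n = ≤-trans (m≤m+n j b) (<⇒≤ j+b<2n)

  ∈-ΔZ : ∀ (Σ′ : CycleGraph n) {a b j} → 0 < j → a < 2n → b < 2n → a ≡ b + j →
         Adjacent (graphEdges Σ′) (vertex a) (vertex b) →
         ∀ z → toℕ z ≡ j ⊎ toℕ z ≡ 2n ∸ j → z ∈ ΔZ Σ′
  ∈-ΔZ Σ′ 0<j a<2n b<2n a≡b+j (inj₁ e) z (inj₁ z≡j)    =
    ∈-concatMap⁺′ e (here (toℕ-injective (trans z≡j (sym (toℕ-residue-minus a<2n b<2n a≡b+j)))))
  ∈-ΔZ Σ′ 0<j a<2n b<2n a≡b+j (inj₁ e) z (inj₂ z≡2n-j) =
    ∈-concatMap⁺′ e (there (here (toℕ-injective (trans z≡2n-j (sym (toℕ-residue-minus′ 0<j a<2n b<2n a≡b+j))))))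
  ∈-ΔZ Σ′ 0<j a<2n b<2n a≡b+j (inj₂ e) z (inj₁ z≡j)    =
    ∈-concatMap⁺′ e (there (here (toℕ-injective (trans z≡j (sym (toℕ-residue-minus a<2n b<2n a≡b+j))))))
  ∈-ΔZ Σ′ 0<j a<2n b<2n a≡b+j (inj₂ e) z (inj₂ z≡2n-j) =
    ∈-concatMap⁺′ e (here (toℕ-injective (trans z≡2n-j (sym (toℕ-residue-minus′ 0<j a<2n b<2n a≡b+j)))))

  module _ (Σ′ : CycleGraph n) (es : List (ℕ × ℕ))
           (lifts : ∀ {a b} → (a , b) ∈ es → (vertex a , vertex b) ∈ graphEdges Σ′)
           (bounded : ∀ {a b} → (a , b) ∈ es → a < 2n × b < 2n) where

    ΔZ-difference : ∀ {j} → 0 < j → HasDifference es j → ∀ z → toℕ z ≡ j ⊎ toℕ z ≡ 2n ∸ j → z ∈ ΔZ Σ′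
    ΔZ-difference 0<j (a , b , a≡b+j , inj₁ e) =
      ∈-ΔZ Σ′ 0<j (proj₁ (bounded e)) (proj₂ (bounded e)) a≡b+j (inj₁ (lifts e))
    ΔZ-difference 0<j (a , b , a≡b+j , inj₂ e) =
      ∈-ΔZ Σ′ 0<j (proj₂ (bounded e)) (proj₁ (bounded e)) a≡b+j (inj₂ (lifts e))

    ΔZ-complete : (∀ j → 0 < j → j ≤ n → HasDifference es j) → ∀ z → toℕ z ≢ 0 → z ∈ ΔZ Σ′
    ΔZ-complete differences z z≢0 with toℕ z ≤? n
    ... | yes z≤half = ΔZ-difference 0<z (differences (toℕ z) 0<z z≤half) z (inj₁ refl)
      where 0<z = n≢0⇒n>0 z≢0
    ... | no z≰half = ΔZ-difference 0<j (differences (2n ∸ toℕ z) 0<j j≤n) z (inj₂ (sym (m∸[m∸n]≡n (<⇒≤ (toℕ<n z)))))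
      where
      0<j : 0 < 2n ∸ toℕ z
      0<j = m<n⇒0<n∸m (toℕ<n z)
      j≤n : 2n ∸ toℕ z ≤ n
      j≤n = subst (2n ∸ toℕ z ≤_) (trans (cong (_∸ n) 2n≡n+n) (m+n∸n≡m n n)) (∸-monoʳ-≤ 2n (<⇒≤ (≰⇒> z≰half)))

-- The starter

record NormalForm (ε m : ℕ) (L : List ℕ) : Set where
  field
    u            : ℕ
    longCycles   : List (List ℕ)
    front back   : List ℕ
    cycleLengths : map length longCycles ↭ L
    vertexSet    : u ∷ u + 3 ∷ concat longCycles ++ front ++ 0 ∷ ε ∷ back ↭ upTo (suc ε)
    pathLength   : suc (length front + length back) ≡ m
    differences  : ∀ k → 0 < k → k ≤ ε → k ≢ 2 →
      HasDifference (cycleEdges (u ∷ u + 3 ∷ []) ++ concatMap cycleEdges longCycles ++ pathEdges (front ++ 0 ∷ ε ∷ back)) k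

module Starter {ε m L} (allL : All (2 <_) L) (nf : NormalForm ε m L) where

  open NormalForm nf
  open Residues (2 + ε)

  H H′ F : List ℕ
  H  = front ++ 0 ∷ suc ε + n ∷ suc (suc ε) ∷ map (_+ n) (ε ∷ back)
  H′ = map (_+ n) front ++ n ∷ suc ε ∷ suc (suc ε) + n ∷ ε ∷ back
  F  = u ∷ u + 3 ∷ u + n ∷ u + 3 + n ∷ []

  otherCycles : List (List ℕ)
  otherCycles = F ∷ longCycles ++ map (map (_+ n)) longCycles

  infinityCycle : List (V n)
  infinityCycle = ∞ ∷ map vertex H ++ reverse (map vertex H′)

  starter : CycleGraph n
  starter = infinityCycle ∷ map (map vertex) otherCycles

  verticesℕ : List ℕ
  verticesℕ = concat otherCycles ++ H ++ reverse H′

  edgesℕ : List (ℕ × ℕ)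
  edgesℕ = concatMap cycleEdges otherCycles ++ pathEdges (H ++ reverse H′)

  private
    C C⁺ W : List ℕ
    C  = concat longCycles
    C⁺ = map (_+ n) C
    W  = u ∷ u + 3 ∷ C ++ front ++ 0 ∷ ε ∷ back

    top : List ℕ
    top = upTo (suc ε) ++ suc ε ∷ suc (suc ε) ∷ []

    upTo-2n : upTo 2n ≡ top ++ map (_+ n) top
    upTo-2n = begin
      upTo 2n                          ≡⟨ cong upTo 2n≡n+n ⟩
      upTo (n + n)                     ≡⟨ upTo-+ n n ⟩
      upTo n ++ map (_+ n) (upTo n)    ≡⟨ cong (λ xs → xs ++ map (_+ n) xs) upTo-n ⟨
      top ++ map (_+ n) top            ∎
      where
      open ≡-Reasoning
      upTo-n : top ≡ upTo n
      upTo-n = trans (sym (++-assoc (upTo (suc ε)) [ suc ε ] [ suc (suc ε) ]))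
                 (trans (cong (_∷ʳ suc (suc ε)) (applyUpTo-∷ʳ (λ i → i) (suc ε))) (applyUpTo-∷ʳ (λ i → i) (suc (suc ε))))

    W⁺ : List ℕ
    W⁺ = u + n ∷ u + 3 + n ∷ C⁺ ++ map (_+ n) front ++ n ∷ ε + n ∷ map (_+ n) back

    map-W : map (_+ n) (W ++ suc ε ∷ suc (suc ε) ∷ []) ≡ W⁺ ++ suc ε + n ∷ suc (suc ε) + n ∷ []
    map-W = begin
      map (_+ n) (W ++ suc ε ∷ suc (suc ε) ∷ [])            ≡⟨ map-++ (_+ n) W _ ⟩
      map (_+ n) W ++ suc ε + n ∷ suc (suc ε) + n ∷ []      ≡⟨ cong (λ xs → u + n ∷ u + 3 + n ∷ xs ++ _) middle ⟩
      W⁺ ++ suc ε + n ∷ suc (suc ε) + n ∷ []                ∎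
      where
      open ≡-Reasoning
      middle : map (_+ n) (C ++ front ++ 0 ∷ ε ∷ back) ≡ C⁺ ++ map (_+ n) front ++ n ∷ ε + n ∷ map (_+ n) back
      middle = trans (map-++ (_+ n) C _) (cong (C⁺ ++_) (map-++ (_+ n) front _))

    rearrange : F ++ (C ++ C⁺) ++ H ++ H′ ↭ (W ++ suc ε ∷ suc (suc ε) ∷ []) ++ (W⁺ ++ suc ε + n ∷ suc (suc ε) + n ∷ [])
    rearrange = prove 18
        ((vu ⊕ (vw ⊕ (vun ⊕ vwn))) ⊕ ((c ⊕ c⁺) ⊕ ((f ⊕ (z ⊕ (e1n ⊕ (e2 ⊕ (en ⊕ b⁺))))) ⊕ (f⁺ ⊕ (vn ⊕ (e1 ⊕ (e2n ⊕ (e ⊕ b))))))))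
        (((vu ⊕ (vw ⊕ (c ⊕ (f ⊕ (z ⊕ (e ⊕ b)))))) ⊕ (e1 ⊕ e2)) ⊕ ((vun ⊕ (vwn ⊕ (c⁺ ⊕ (f⁺ ⊕ (vn ⊕ (en ⊕ b⁺)))))) ⊕ (e1n ⊕ e2n)))
        (front Vec.∷ back Vec.∷ C Vec.∷ map (_+ n) front Vec.∷ map (_+ n) back Vec.∷ C⁺ Vec.∷
         [ u ] Vec.∷ [ u + 3 ] Vec.∷ [ u + n ] Vec.∷ [ u + 3 + n ] Vec.∷ [ 0 ] Vec.∷ [ ε ] Vec.∷ [ n ] Vec.∷ [ ε + n ] Vec.∷
         [ suc ε ] Vec.∷ [ suc (suc ε) ] Vec.∷ [ suc ε + n ] Vec.∷ [ suc (suc ε) + n ] Vec.∷ Vec.[])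
      where
      open import Algebra.Solver.CommutativeMonoid (↭ₚ.++-commutativeMonoid {A = ℕ})
      import Data.Vec as Vec
      open import Data.Fin using (#_)
      f = var (# 0); b = var (# 1); c = var (# 2); f⁺ = var (# 3); b⁺ = var (# 4); c⁺ = var (# 5)
      vu = var (# 6); vw = var (# 7); vun = var (# 8); vwn = var (# 9); z = var (# 10); e = var (# 11)
      vn = var (# 12); en = var (# 13); e1 = var (# 14); e2 = var (# 15); e1n = var (# 16); e2n = var (# 17)

  verticesℕ-↭ : verticesℕ ↭ upTo 2n
  verticesℕ-↭ = begin
    F ++ concat (longCycles ++ map (map (_+ n)) longCycles) ++ H ++ reverse H′   ≡⟨ cong (λ xs → F ++ xs ++ H ++ reverse H′) cycles≡ ⟩
    F ++ (C ++ C⁺) ++ H ++ reverse H′                                           ↭⟨ ++⁺ˡ F (++⁺ˡ (C ++ C⁺) (++⁺ˡ H (↭-reverse H′))) ⟩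
    F ++ (C ++ C⁺) ++ H ++ H′                                                   ↭⟨ rearrange ⟩
    (W ++ suc ε ∷ suc (suc ε) ∷ []) ++ (W⁺ ++ suc ε + n ∷ suc (suc ε) + n ∷ [])   ≡⟨ cong ((W ++ suc ε ∷ suc (suc ε) ∷ []) ++_) map-W ⟨
    (W ++ suc ε ∷ suc (suc ε) ∷ []) ++ map (_+ n) (W ++ suc ε ∷ suc (suc ε) ∷ [])  ↭⟨ ++⁺ (++⁺ʳ _ vertexSet) (map⁺ (_+ n) (++⁺ʳ _ vertexSet)) ⟩
    top ++ map (_+ n) top                                                       ≡⟨ upTo-2n ⟨
    upTo 2n                                                                     ∎
    where
    open PermutationReasoning
    cycles≡ : concat (longCycles ++ map (map (_+ n)) longCycles) ≡ C ++ C⁺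
    cycles≡ = trans (sym (concat-++ longCycles _)) (cong (C ++_) (concat-map longCycles))

  starter-vertices : concat starter ↭ allV n
  starter-vertices = ↭-prep ∞ (begin
    (map vertex H ++ reverse (map vertex H′)) ++ concat (map (map vertex) otherCycles)  ↭⟨ ++-comm _ (concat (map (map vertex) otherCycles)) ⟩
    concat (map (map vertex) otherCycles) ++ map vertex H ++ reverse (map vertex H′)    ≡⟨ map-vertex-verticesℕ ⟨
    map vertex verticesℕ                                                               ↭⟨ map⁺ vertex verticesℕ-↭ ⟩
    map vertex (upTo 2n)                                                               ≡⟨ map-vertex-upTo ⟩
    map fin (allFin 2n)                                                                ∎)
    where
    open PermutationReasoning
    map-vertex-verticesℕ : map vertex verticesℕ ≡ concat (map (map vertex) otherCycles) ++ map vertex H ++ reverse (map vertex H′)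
    map-vertex-verticesℕ = trans (map-++ vertex (concat otherCycles) (H ++ reverse H′))
      (cong₂ _++_ (sym (concat-map otherCycles)) (trans (map-++ vertex H (reverse H′)) (cong (map vertex H ++_) (reverse-map vertex H′))))

  translate-map-vertex : ∀ xs → map translate (map vertex xs) ≡ map vertex (map (_+ n) xs)
  translate-map-vertex []       = refl
  translate-map-vertex (x ∷ xs) = cong₂ _∷_ (translate-vertex x) (translate-map-vertex xs)

  map-vertex-+n+n : ∀ xs → map vertex (map (_+ n) (map (_+ n) xs)) ≡ map vertex xs
  map-vertex-+n+n []       = refl
  map-vertex-+n+n (x ∷ xs) = cong₂ _∷_ (vertex-+n+n x) (map-vertex-+n+n xs)

  translate-H : map translate (map vertex H) ≡ map vertex H′
  translate-H = begin
    map translate (map vertex H)                                                    ≡⟨ translate-map-vertex H ⟩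
    map vertex (map (_+ n) H)                                                       ≡⟨ cong (map vertex) (map-++ (_+ n) front _) ⟩
    map vertex (map (_+ n) front ++ n ∷ suc ε + n + n ∷ suc (suc ε) + n ∷ map (_+ n) (map (_+ n) (ε ∷ back)))
                                                                                    ≡⟨ map-++ vertex (map (_+ n) front) _ ⟩
    map vertex (map (_+ n) front) ++ vertex n ∷ vertex (suc ε + n + n) ∷ vertex (suc (suc ε) + n) ∷ map vertex (map (_+ n) (map (_+ n) (ε ∷ back)))
                                                                                    ≡⟨ cong (λ xs → map vertex (map (_+ n) front) ++ vertex n ∷ xs) tail≡ ⟩
    map vertex (map (_+ n) front) ++ vertex n ∷ vertex (suc ε) ∷ vertex (suc (suc ε) + n) ∷ map vertex (ε ∷ back)
                                                                                    ≡⟨ map-++ vertex (map (_+ n) front) _ ⟨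
    map vertex H′                                                                   ∎
    where
    open ≡-Reasoning
    tail≡ : vertex (suc ε + n + n) ∷ vertex (suc (suc ε) + n) ∷ map vertex (map (_+ n) (map (_+ n) (ε ∷ back)))
          ≡ vertex (suc ε) ∷ vertex (suc (suc ε) + n) ∷ map vertex (ε ∷ back)
    tail≡ = cong₂ _∷_ (vertex-+n+n (suc ε)) (cong (vertex (suc (suc ε) + n) ∷_) (map-vertex-+n+n (ε ∷ back)))

  translate-H′ : map translate (map vertex H′) ≡ map vertex H
  translate-H′ = begin
    map translate (map vertex H′)                                                   ≡⟨ translate-map-vertex H′ ⟩
    map vertex (map (_+ n) H′)                                                      ≡⟨ cong (map vertex) (map-++ (_+ n) (map (_+ n) front) _) ⟩
    map vertex (map (_+ n) (map (_+ n) front) ++ n + n ∷ suc ε + n ∷ suc (suc ε) + n + n ∷ ε + n ∷ map (_+ n) back)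
                                                                                    ≡⟨ map-++ vertex (map (_+ n) (map (_+ n) front)) _ ⟩
    map vertex (map (_+ n) (map (_+ n) front)) ++ vertex (n + n) ∷ vertex (suc ε + n) ∷ vertex (suc (suc ε) + n + n) ∷ map vertex (map (_+ n) (ε ∷ back))
                                                                                    ≡⟨ cong₂ _++_ (map-vertex-+n+n front) tail≡ ⟩
    map vertex front ++ vertex 0 ∷ vertex (suc ε + n) ∷ vertex (suc (suc ε)) ∷ map vertex (map (_+ n) (ε ∷ back))
                                                                                    ≡⟨ map-++ vertex front _ ⟨
    map vertex H                                                                    ∎
    where
    open ≡-Reasoning
    tail≡ : vertex (n + n) ∷ vertex (suc ε + n) ∷ vertex (suc (suc ε) + n + n) ∷ map vertex (map (_+ n) (ε ∷ back))
          ≡ vertex 0 ∷ vertex (suc ε + n) ∷ vertex (suc (suc ε)) ∷ map vertex (map (_+ n) (ε ∷ back))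
    tail≡ = cong₂ _∷_ (vertex-+n+n 0) (cong (λ v → vertex (suc ε + n) ∷ v ∷ map vertex (map (_+ n) (ε ∷ back))) (vertex-+n+n (suc (suc ε))))

  translate-cycles : ∀ cs → map (map translate) (map (map vertex) cs) ≡ map (map vertex) (map (map (_+ n)) cs)
  translate-cycles []       = refl
  translate-cycles (c ∷ cs) = cong₂ _∷_ (translate-map-vertex c) (translate-cycles cs)

  translate-cycles⁺ : ∀ cs → map (map translate) (map (map vertex) (map (map (_+ n)) cs)) ≡ map (map vertex) cs
  translate-cycles⁺ []       = refl
  translate-cycles⁺ (c ∷ cs) = cong₂ _∷_ (trans (translate-map-vertex (map (_+ n) c)) (map-vertex-+n+n c)) (translate-cycles⁺ cs)

  private
    PH PH′ infinityCycle⁺ F⁺ : List (V n)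
    PH  = map vertex H
    PH′ = map vertex H′
    infinityCycle⁺ = ∞ ∷ PH′ ++ reverse PH
    F⁺  = vertex (u + n) ∷ vertex (u + 3 + n) ∷ vertex u ∷ vertex (u + 3) ∷ []

    R R⁺ : CycleGraph n
    R  = map (map vertex) longCycles
    R⁺ = map (map vertex) (map (map (_+ n)) longCycles)

  shift-starter : shift starter ≡ infinityCycle⁺ ∷ F⁺ ∷ R⁺ ++ R
  shift-starter = trans (shift≡map-translate starter) (cong₂ _∷_ (cong (∞ ∷_) path≡) (cong₂ _∷_ F≡ cycles≡))
    where
    path≡ : map translate (PH ++ reverse PH′) ≡ PH′ ++ reverse PH
    path≡ = trans (map-++ translate PH (reverse PH′))
      (cong₂ _++_ translate-H (trans (reverse-map translate PH′) (cong reverse translate-H′)))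
    F≡ : map translate (map vertex F) ≡ F⁺
    F≡ = trans (translate-map-vertex F)
      (cong (λ xs → vertex (u + n) ∷ vertex (u + 3 + n) ∷ xs) (cong₂ _∷_ (vertex-+n+n u) (cong (_∷ []) (vertex-+n+n (u + 3)))))
    cycles≡ : map (map translate) (map (map vertex) (longCycles ++ map (map (_+ n)) longCycles)) ≡ R⁺ ++ R
    cycles≡ = trans (cong (map (map translate)) (map-++ (map vertex) longCycles _))
      (trans (map-++ (map translate) R R⁺) (cong₂ _++_ (translate-cycles longCycles) (translate-cycles⁺ longCycles)))

  starter-shift : bothDirs (graphEdges (shift starter)) ↭ bothDirs (graphEdges starter)
  starter-shift = begin
    bothDirs (graphEdges (shift starter))             ≡⟨ cong (bothDirs ∘ graphEdges) shift-starter ⟩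
    bothDirs (cycleEdges infinityCycle⁺ ++ rest⁺)     ↭⟨ bothDirs-++⁺ (cycleEdges infinityCycle⁺) (cycleEdges infinityCycle) rest⁺ rest flip rotate ⟩
    bothDirs (cycleEdges infinityCycle ++ rest)       ≡⟨ cong (λ X → bothDirs (cycleEdges infinityCycle ++ cycleEdges (map vertex F) ++ graphEdges X))
                                                              (map-++ (map vertex) longCycles _) ⟨
    bothDirs (graphEdges starter)                     ∎
    where
    open PermutationReasoning
    rest⁺ rest : List (V n × V n)
    rest⁺ = cycleEdges F⁺ ++ graphEdges (R⁺ ++ R)
    rest  = cycleEdges (map vertex F) ++ graphEdges (R ++ R⁺)
    flip : bothDirs (cycleEdges infinityCycle⁺) ↭ bothDirs (cycleEdges infinityCycle)
    flip = cycleEdges-flip ∞ PH′ PH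
    rotate : bothDirs rest⁺ ↭ bothDirs rest
    rotate = bothDirs-↭ (++⁺ (cycleEdges-rotate (vertex u) (vertex (u + 3)) (vertex (u + n)) (vertex (u + 3 + n)))
                             (concatMap-cycleEdges-comm R⁺ R))

  private
    inH : ∀ {e} → e ∈ pathEdges H → e ∈ edgesℕ
    inH p = ∈-++⁺ʳ (concatMap cycleEdges otherCycles) (∈-pathEdges-++⁺ˡ H (reverse H′) p)

    inH′ : ∀ {e} → e ∈ pathEdges H′ → swap e ∈ edgesℕ
    inH′ p = ∈-++⁺ʳ (concatMap cycleEdges otherCycles) (∈-pathEdges-++⁺ʳ H (reverse H′) (∈-pathEdges-reverse H′ p))

    inF : ∀ {e} → e ∈ cycleEdges F → e ∈ edgesℕ
    inF p = ∈-++⁺ˡ (∈-++⁺ˡ {ys = concatMap cycleEdges (longCycles ++ map (map (_+ n)) longCycles)} p)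

    inLong : ∀ {e} → e ∈ concatMap cycleEdges longCycles → e ∈ edgesℕ
    inLong {e} p = ∈-++⁺ˡ (∈-++⁺ʳ (cycleEdges F) (subst (e ∈_) (sym (concatMap-++ cycleEdges longCycles _)) (∈-++⁺ˡ p)))

    labelEdges : List (ℕ × ℕ)
    labelEdges = cycleEdges (u ∷ u + 3 ∷ []) ++ concatMap cycleEdges longCycles ++ pathEdges (front ++ 0 ∷ ε ∷ back)

  lift-label-edge : ∀ {a b} → (a , b) ∈ labelEdges → (a , b) ≢ (0 , ε) → Adjacent edgesℕ a b ⊎ Adjacent edgesℕ (a + n) (b + n)
  lift-label-edge (here refl)         _ = inj₁ (inj₁ (inF (here refl)))
  lift-label-edge (there (here refl)) _ = inj₁ (inj₂ (inF (here refl)))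
  lift-label-edge {a} {b} (there (there p)) not-0ε with ∈-++⁻ (concatMap cycleEdges longCycles) p
  ... | inj₁ q = inj₁ (inj₁ (inLong q))
  ... | inj₂ q with ∈-pathEdges-split front 0 ε back q
  ...   | inj₁ r        = inj₁ (inj₁ (inH (subst (λ xs → (a , b) ∈ pathEdges xs) (++-assoc front [ 0 ] _) (∈-pathEdges-++⁺ˡ (front ++ [ 0 ]) _ r))))
  ...   | inj₂ (inj₁ r) = ⊥-elim (not-0ε r)
  ...   | inj₂ (inj₂ r) = inj₂ (inj₁ (inH (∈-pathEdges-++⁺ʳ front _ (∈-pathEdges-++⁺ʳ (0 ∷ suc ε + n ∷ suc (suc ε) ∷ []) _
                            (∈-pathEdges-map (_+ n) (ε ∷ back) r)))))

  lifted-difference : ∀ {a b j} → a ≡ b + j → Adjacent edgesℕ a b ⊎ Adjacent edgesℕ (a + n) (b + n) → HasDifference edgesℕ j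
  lifted-difference {a} {b} {j} a≡b+j (inj₁ adj) = a , b , a≡b+j , adj
  lifted-difference {a} {b} {j} a≡b+j (inj₂ adj) = a + n , b + n , trans (cong (_+ n) a≡b+j) (xy∙z≈xz∙y b j n) , adj
    where open import Algebra.Properties.CommutativeSemigroup +-commutativeSemigroup using (xy∙z≈xz∙y)

  ordinary-difference : ∀ j → 0 < j → j ≤ ε → j ≢ 2 → j ≢ ε → HasDifference edgesℕ j
  ordinary-difference j 0<j j≤ε j≢2 j≢ε with differences j 0<j j≤ε j≢2
  ... | a , b , a≡b+j , inj₁ e = lifted-difference a≡b+j (lift-label-edge e not-0ε)
    where
    not-0ε : (a , b) ≢ (0 , ε)
    not-0ε eq = <⇒≱ 0<j (subst (j ≤_) (trans (cong (_+ j) (sym (,-injectiveʳ eq))) (trans (sym a≡b+j) (,-injectiveˡ eq))) (m≤n+m j ε))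
  ... | a , b , a≡b+j , inj₂ e = lifted-difference a≡b+j (Sum.map Sum.swap Sum.swap (lift-label-edge e not-0ε))
    where
    not-0ε : (b , a) ≢ (0 , ε)
    not-0ε eq = j≢ε (trans (cong (_+ j) (sym (,-injectiveˡ eq))) (trans (sym a≡b+j) (,-injectiveʳ eq)))

  difference-2 : HasDifference edgesℕ 2
  difference-2 = n , suc ε , +-comm 2 (suc ε) , inj₂ (inH′ (∈-pathEdges-middle (map (_+ n) front) n (suc ε) _))

  difference-ε : HasDifference edgesℕ ε
  difference-ε = u + n , u + 3 , sym (+-assoc u 3 ε) , inj₂ (inF (there (here refl)))

  difference-ε+1 : HasDifference edgesℕ (suc ε)
  difference-ε+1 = ε + n , suc (suc ε) , trans (+-suc ε _) (cong suc (+-suc ε (suc ε))) ,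
    inj₂ (inH (∈-pathEdges-++⁺ʳ front _ (there (there (here refl)))))

  difference-ε+2 : HasDifference edgesℕ (suc (suc ε))
  difference-ε+2 = suc ε + n , suc (suc ε) , cong suc (+-suc ε (suc (suc ε))) ,
    inj₁ (inH (∈-pathEdges-++⁺ʳ front _ (there (here refl))))

  difference-n : HasDifference edgesℕ n
  difference-n with ∃-snoc ε back
  ... | B , ℓ , ε∷back≡B∷ʳℓ = ℓ + n , ℓ , refl ,
    inj₁ (∈-++⁺ʳ (concatMap cycleEdges otherCycles) (subst₂ (λ X Y → (ℓ + n , ℓ) ∈ pathEdges (X ++ reverse Y)) (sym H≡) (sym H′≡)
      (∈-pathEdges-turn (front ++ 0 ∷ suc ε + n ∷ suc (suc ε) ∷ map (_+ n) B) (map (_+ n) front ++ n ∷ suc ε ∷ suc (suc ε) + n ∷ B) (ℓ + n) ℓ)))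
    where
    H≡ : H ≡ (front ++ 0 ∷ suc ε + n ∷ suc (suc ε) ∷ map (_+ n) B) ++ [ ℓ + n ]
    H≡ = trans (cong (λ xs → front ++ 0 ∷ suc ε + n ∷ suc (suc ε) ∷ xs) (trans (cong (map (_+ n)) ε∷back≡B∷ʳℓ) (map-++ (_+ n) B [ ℓ ])))
               (sym (++-assoc front _ [ ℓ + n ]))
    H′≡ : H′ ≡ (map (_+ n) front ++ n ∷ suc ε ∷ suc (suc ε) + n ∷ B) ++ [ ℓ ]
    H′≡ = trans (cong (λ xs → map (_+ n) front ++ n ∷ suc ε ∷ suc (suc ε) + n ∷ xs) ε∷back≡B∷ʳℓ) (sym (++-assoc (map (_+ n) front) _ [ ℓ ]))

  edgesℕ-differences : ∀ j → 0 < j → j ≤ n → HasDifference edgesℕ j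
  edgesℕ-differences j 0<j j≤n with j ≟ 2 | j ≟ ε
  ... | yes refl | _        = difference-2
  ... | no _     | yes refl = difference-ε
  ... | no j≢2   | no j≢ε with j ≤? ε
  ...   | yes j≤ε = ordinary-difference j 0<j j≤ε j≢2 j≢ε
  ...   | no j≰ε with j ≟ suc ε | j ≟ suc (suc ε)
  ...     | yes refl | _        = difference-ε+1
  ...     | no _     | yes refl = difference-ε+2
  ...     | no j≢ε+1 | no j≢ε+2 = subst (HasDifference edgesℕ) (sym j≡n) difference-n
    where
    j≡n : j ≡ n
    j≡n = ≤-antisym j≤n (≤∧≢⇒< (≤∧≢⇒< (≰⇒> j≰ε) (j≢ε+1 ∘ sym)) (j≢ε+2 ∘ sym))

  edgesℕ-lift : ∀ {a b} → (a , b) ∈ edgesℕ → (vertex a , vertex b) ∈ graphEdges starter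
  edgesℕ-lift {a} {b} p with ∈-++⁻ (concatMap cycleEdges otherCycles) p
  ... | inj₁ q = let c , c∈ , e∈c = ∈-concatMap⁻′ cycleEdges {otherCycles} q in
    ∈-++⁺ʳ (cycleEdges infinityCycle) (∈-concatMap⁺′ {f = cycleEdges} (∈-map⁺ (map vertex) c∈) (∈-cycleEdges-map vertex c e∈c))
  ... | inj₂ q = ∈-++⁺ˡ (∈-pathEdges-++⁺ʳ [ ∞ ] _ (∈-pathEdges-++⁺ˡ (map vertex H ++ reverse (map vertex H′)) [ ∞ ] on-path))
    where
    on-path : (vertex a , vertex b) ∈ pathEdges (map vertex H ++ reverse (map vertex H′))
    on-path = subst (λ xs → (vertex a , vertex b) ∈ pathEdges xs)
      (trans (map-++ vertex H (reverse H′)) (cong (map vertex H ++_) (reverse-map vertex H′)))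
      (∈-pathEdges-map vertex (H ++ reverse H′) q)

  edgesℕ-bounded : ∀ {a b} → (a , b) ∈ edgesℕ → a < 2n × b < 2n
  edgesℕ-bounded p = Prod.map bounded bounded (∈-edges-endpoints otherCycles (H ++ reverse H′) p)
    where
    bounded : ∀ {x} → x ∈ verticesℕ → x < 2n
    bounded x∈ = ∈-upTo⁻ (∈-resp-↭ verticesℕ-↭ x∈)

  starter-length : length infinityCycle ≡ 2 * m + 7
  starter-length = begin
    suc (length (map vertex H ++ reverse (map vertex H′)))     ≡⟨ cong suc (length-++ (map vertex H)) ⟩
    suc (length (map vertex H) + length (reverse (map vertex H′)))
      ≡⟨ cong₂ (λ x y → suc (x + y)) (trans (length-map vertex H) length-H) (trans (length-reverse (map vertex H′)) (trans (length-map vertex H′) length-H′)) ⟩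
    suc (length front + (4 + length back) + (length front + (4 + length back)))  ≡⟨ length-arithmetic (length front) (length back) ⟩
    2 * suc (length front + length back) + 7                   ≡⟨ cong (λ k → 2 * k + 7) pathLength ⟩
    2 * m + 7                                                  ∎
    where
    open ≡-Reasoning
    open import Data.Nat.Tactic.RingSolver using (solve-∀)
    length-arithmetic : ∀ a b → suc (a + (4 + b) + (a + (4 + b))) ≡ 2 * suc (a + b) + 7
    length-arithmetic = solve-∀
    length-H : length H ≡ length front + (4 + length back)
    length-H = trans (length-++ front) (cong (λ k → length front + (4 + k)) (length-map (_+ n) back))
    length-H′ : length H′ ≡ length front + (4 + length back)
    length-H′ = trans (length-++ (map (_+ n) front) {n ∷ suc ε ∷ suc (suc ε) + n ∷ ε ∷ back}) (cong (_+ (4 + length back)) (length-map (_+ n) front))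

  other-lengths : map length (map (map vertex) (longCycles ++ map (map (_+ n)) longCycles)) ↭ L ++ L
  other-lengths = begin
    map length (map (map vertex) (longCycles ++ map (map (_+ n)) longCycles))  ≡⟨ map-length-map vertex (longCycles ++ _) ⟩
    map length (longCycles ++ map (map (_+ n)) longCycles)                     ≡⟨ map-++ length longCycles _ ⟩
    map length longCycles ++ map length (map (map (_+ n)) longCycles)          ≡⟨ cong (map length longCycles ++_) (map-length-map (_+ n) longCycles) ⟩
    map length longCycles ++ map length longCycles                             ↭⟨ ++⁺ cycleLengths cycleLengths ⟩
    L ++ L                                                                     ∎
    where
    open PermutationReasoning

  starter-type : HasType starter (2 * m + 7) (4 ∷ L ++ L)
  starter-type = infinityCycle , map (map vertex) otherCycles , ↭-refl , here refl , starter-length , ↭-prep 4 other-lengths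

  starter-cycles : All (λ c → 2 ≤ length c) starter
  starter-cycles = subst (2 ≤_) (sym starter-length) (≤-trans (s≤s (s≤s z≤n)) (m≤n+m 7 (2 * m)))
                 ∷ s≤s (s≤s z≤n)
                 ∷ Allₚ.map⁻ (All-resp-↭ (↭-sym other-lengths) (Allₚ.++⁺ L-long L-long))
    where
    L-long : All (2 ≤_) L
    L-long = All.map <⇒≤ allL

  starter-is-2-starter : Is2Starter n starter
  starter-is-2-starter = starter-cycles , starter-vertices ,
    ΔZ-complete starter edgesℕ edgesℕ-lift edgesℕ-bounded edgesℕ-differences , starter-shift

-- From a graceful labeling to its normal form

count : ℤ → List ℤ → ℕ
count d = length ∘ filter (d ℤₚ.≟_)

count-↭ : ∀ d {xs ys} → xs ↭ ys → count d xs ≡ count d ys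
count-↭ d p = ↭-length (filter-↭ (d ℤₚ.≟_) p)

count-here : ∀ {d x} xs → d ≡ x → count d (x ∷ xs) ≡ suc (count d xs)
count-here {d} xs d≡x = cong length (filter-accept (_ ℤₚ.≟_) d≡x)

count-there : ∀ {d x} xs → d ≢ x → count d (x ∷ xs) ≡ count d xs
count-there xs d≢x = cong length (filter-reject (_ ℤₚ.≟_) d≢x)

count-none : ∀ {d} xs → All (d ≢_) xs → count d xs ≡ 0
count-none xs ds = cong length (filter-none (_ ℤₚ.≟_) ds)

+≢-+ : ∀ {a b} → 0 < b → + a ≢ - + b
+≢-+ {b = suc b} _ ()

pm-avoids : ∀ {d} xs → All (λ y → d ≢ + y × d ≢ - + y) xs → All (d ≢_) (pm (map +_ xs))
pm-avoids []       []                   = []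
pm-avoids (x ∷ xs) ((d≢y , d≢-y) ∷ ps) = d≢y ∷ d≢-y ∷ pm-avoids xs ps

count-pm≤1 : ∀ d {xs} → AllPairs _<_ xs → All (0 <_) xs → count d (pm (map +_ xs)) ≤ 1
count-pm≤1 d {[]}     []          []          = z≤n
count-pm≤1 d {x ∷ xs} (x< ∷ incr) (0<x ∷ pos) = by-cases (d ℤₚ.≟ + x) (d ℤₚ.≟ - + x)
  where
  open ≡-Reasoning
  rest = pm (map +_ xs)

  by-cases : Dec (d ≡ + x) → Dec (d ≡ - + x) → count d (+ x ∷ - + x ∷ rest) ≤ 1
  by-cases (yes d≡x) _ = ≤-reflexive (begin
    count d (+ x ∷ - + x ∷ rest)  ≡⟨ count-here _ d≡x ⟩
    suc (count d (- + x ∷ rest))  ≡⟨ cong suc (count-there rest (+≢-+ 0<x ∘ trans (sym d≡x))) ⟩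
    suc (count d rest)            ≡⟨ cong suc (count-none rest (pm-avoids xs (All.map above x<))) ⟩
    1                             ∎)
    where
    above : ∀ {y} → x < y → d ≢ + y × d ≢ - + y
    above x<y = (λ eq → <-irrefl (ℤₚ.+-injective (trans (sym d≡x) eq)) x<y)
              , (λ eq → +≢-+ (≤-trans 0<x (<⇒≤ x<y)) (trans (sym d≡x) eq))
  by-cases (no d≢x) (yes d≡-x) = ≤-reflexive (begin
    count d (+ x ∷ - + x ∷ rest)  ≡⟨ count-there (- + x ∷ rest) d≢x ⟩
    count d (- + x ∷ rest)        ≡⟨ count-here rest d≡-x ⟩
    suc (count d rest)            ≡⟨ cong suc (count-none rest (pm-avoids xs (All.map below x<))) ⟩
    1                             ∎)
    where
    below : ∀ {y} → x < y → d ≢ + y × d ≢ - + y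
    below x<y = (λ eq → +≢-+ 0<x (trans (sym eq) d≡-x))
              , (λ eq → <-irrefl (ℤₚ.+-injective (ℤₚ.neg-injective (trans (sym d≡-x) eq))) x<y)
  by-cases (no d≢x) (no d≢-x) =
    subst (_≤ 1) (sym (trans (count-there _ d≢x) (count-there _ d≢-x))) (count-pm≤1 d incr pos)

-- The differences of a graceful labeling of [L, 2 | m]_ε, regrouped so that only ±3 is repeated.
spectrum-↭ : ∀ ε → pm (+ 1 ∷ + 3 ∷ + 3 ∷ []) ++ pm (I 4 ε) ↭ + 3 ∷ - + 3 ∷ pm (map +_ (1 ∷ 3 ∷ applyUpTo (4 ℕ.+_) (suc ε ∸ 4)))
spectrum-↭ ε = ↭-trans (shifts (+ 1 ∷ - + 1 ∷ []) (+ 3 ∷ - + 3 ∷ []))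
  (↭-reflexive (cong (λ ds → + 3 ∷ - + 3 ∷ + 1 ∷ - + 1 ∷ + 3 ∷ - + 3 ∷ pm ds) I≡))
  where
  K = suc ε ∸ 4
  I≡ : I 4 ε ≡ map +_ (applyUpTo (4 ℕ.+_) K)
  I≡ = trans (map-upTo _ K) (sym (map-applyUpTo (4 ℕ.+_) +_ K))

double-difference : ∀ ε D R → D ∷ D ∷ R ↭ pm (+ 1 ∷ + 3 ∷ + 3 ∷ []) ++ pm (I 4 ε) → D ≡ + 3 ⊎ D ≡ - + 3
double-difference ε D R p with D ℤₚ.≟ + 3 | D ℤₚ.≟ - + 3
... | yes D≡3 | _        = inj₁ D≡3
... | no _    | yes D≡-3 = inj₂ D≡-3
... | no D≢3  | no D≢-3  = ⊥-elim (2≰1 (≤-trans twice once))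
  where
  ds = 1 ∷ 3 ∷ applyUpTo (4 ℕ.+_) (suc ε ∸ 4)
  2≰1 : ¬ 2 ≤ 1
  2≰1 (s≤s ())
  twice : 2 ≤ count D (D ∷ D ∷ R)
  twice = subst (2 ≤_) (sym (trans (count-here {D} (D ∷ R) refl) (cong suc (count-here {D} R refl)))) (s≤s (s≤s z≤n))
  increasing : AllPairs _<_ ds
  increasing = (s≤s (s≤s z≤n) ∷ Allₚ.applyUpTo⁺₂ _ _ (λ _ → s≤s (s≤s z≤n)))
             ∷ Allₚ.applyUpTo⁺₂ _ _ (λ _ → s≤s (s≤s (s≤s (s≤s z≤n))))
             ∷ AllPairsₚ.applyUpTo⁺₁ _ _ (λ i<j _ → +-monoʳ-< 4 i<j)
  positive : All (0 <_) ds
  positive = s≤s z≤n ∷ s≤s z≤n ∷ Allₚ.applyUpTo⁺₂ _ _ (λ _ → s≤s z≤n)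
  once : count D (D ∷ D ∷ R) ≤ 1
  once = subst (_≤ 1) (sym (begin
    count D (D ∷ D ∷ R)                        ≡⟨ count-↭ D (↭-trans p (spectrum-↭ ε)) ⟩
    count D (+ 3 ∷ - + 3 ∷ pm (map +_ ds))     ≡⟨ count-there _ D≢3 ⟩
    count D (- + 3 ∷ pm (map +_ ds))           ≡⟨ count-there _ D≢-3 ⟩
    count D (pm (map +_ ds))                   ∎)) (count-pm≤1 D increasing positive)
    where open ≡-Reasoning

∈-spectrum : ∀ ε k → 0 < k → k ≤ ε → k ≢ 2 → + k ∈ pm (+ 1 ∷ + 3 ∷ + 3 ∷ []) ++ pm (I 4 ε)
∈-spectrum ε k 0<k k≤ε k≢2 =
  ∈-resp-↭ (↭-sym (spectrum-↭ ε)) (there (there (∈-concatMap⁺′ {f = λ d → d ∷ - d ∷ []} (∈-map⁺ +_ k∈ds) (here refl))))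
  where
  k∈ds : k ∈ 1 ∷ 3 ∷ applyUpTo (4 ℕ.+_) (suc ε ∸ 4)
  k∈ds with k ℕ.≟ 1 | k ℕ.≟ 3
  ... | yes refl | _        = here refl
  ... | no _     | yes refl = there (here refl)
  ... | no k≢1   | no k≢3   = there (there (subst (_∈ applyUpTo (4 ℕ.+_) (suc ε ∸ 4)) (m+[n∸m]≡n 4≤k) (∈-applyUpTo⁺ (4 ℕ.+_) k∸4<)))
    where
    4≤k : 4 ≤ k
    4≤k = ≤∧≢⇒< (≤∧≢⇒< (≤∧≢⇒< 0<k (k≢1 ∘ sym)) (k≢2 ∘ sym)) (k≢3 ∘ sym)
    k∸4< : k ∸ 4 < suc ε ∸ 4
    k∸4< = subst (_≤ suc ε ∸ 4) (+-∸-assoc 1 4≤k) (∸-monoˡ-≤ 4 (s≤s k≤ε))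

minus≡⇒≡+ : ∀ a b k → + a ℤ.- + b ≡ + k → a ≡ b + k
minus≡⇒≡+ a b k eq with b ≤? a
... | yes b≤a = trans (sym (m+[n∸m]≡n b≤a)) (cong (b ℕ.+_) (ℤₚ.+-injective (trans (sym (ℤₚ.⊖-≥ b≤a)) a⊖b≡k)))
  where a⊖b≡k = trans (sym (ℤₚ.[+m]-[+n]≡m⊖n a b)) eq
... | no b≰a  = ⊥-elim (negative (trans (sym (ℤₚ.⊖-< (≰⇒> b≰a))) (trans (sym (ℤₚ.[+m]-[+n]≡m⊖n a b)) eq)))
  where
  negative : - + (b ∸ a) ≢ + k
  negative with b ∸ a | m<n⇒0<n∸m (≰⇒> b≰a)
  ... | suc _ | _ = λ ()

minus-swap : ∀ p q → + p ℤ.- + q ≡ - (+ q ℤ.- + p)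
minus-swap p q = trans (ℤₚ.[+m]-[+n]≡m⊖n p q) (trans (ℤₚ.⊖-swap p q) (cong -_ (sym (ℤₚ.[+m]-[+n]≡m⊖n q p))))

Natural : ℤ → Set
Natural x = x ≡ + ∣ x ∣

∈-I⇒natural : ∀ {x b} → x ∈ I 0 b → Natural x × ∣ x ∣ ≤ b
∈-I⇒natural x∈ with ∈-map⁻ (λ i → + (0 + i)) x∈
... | i , i∈ , refl = refl , ℕ.s≤s⁻¹ (∈-upTo⁻ i∈)

map-∣∣-I : ∀ b → map ∣_∣ (I 0 b) ≡ upTo (suc b)
map-∣∣-I b = trans (sym (map-∘ (upTo (suc b)))) (map-id (upTo (suc b)))

∈-Δℤ⇒HasDifference : ∀ {k} (es : List (ℤ × ℤ)) → (∀ {x y} → (x , y) ∈ es → Natural x × Natural y) →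
  + k ∈ Δℤ es → HasDifference (map (Prod.map ∣_∣ ∣_∣) es) k
∈-Δℤ⇒HasDifference es natural k∈ with ∈-concatMap⁻′ _ {es} k∈
... | (x , y) , e , here k≡x-y         = ∣ x ∣ , ∣ y ∣ , difference (natural e) k≡x-y , inj₁ (∈-map⁺ _ e)
  where
  difference : Natural x × Natural y → + _ ≡ x ℤ.- y → ∣ x ∣ ≡ ∣ y ∣ + _
  difference (x≡ , y≡) eq = minus≡⇒≡+ ∣ x ∣ ∣ y ∣ _ (trans (cong₂ ℤ._-_ (sym x≡) (sym y≡)) (sym eq))
... | (x , y) , e , there (here k≡y-x) = ∣ y ∣ , ∣ x ∣ , difference (natural e) k≡y-x , inj₂ (∈-map⁺ _ e)
  where
  difference : Natural x × Natural y → + _ ≡ y ℤ.- x → ∣ y ∣ ≡ ∣ x ∣ + _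
  difference (x≡ , y≡) eq = minus≡⇒≡+ ∣ y ∣ ∣ x ∣ _ (trans (cong₂ ℤ._-_ (sym y≡) (sym x≡)) (sym eq))

extract-2-cycle : ∀ {A : Set} (cs : List (List A)) L → map length cs ↭ 2 ∷ L →
  ∃₂ λ x y → ∃ λ others → (cs ↭ (x ∷ y ∷ []) ∷ others) × (map length others ↭ L)
extract-2-cycle cs L lengths with ∈-map⁻ length (∈-resp-↭ (↭-sym lengths) (here refl))
... | x ∷ y ∷ [] , c∈cs , _ with ∈-∃++ c∈cs
...   | X , Y , refl = x , y , X ++ Y , cs↭ , drop-∷ (↭-trans (↭-sym (map⁺ length cs↭)) lengths)
  where cs↭ = ↭-shift (x ∷ y ∷ []) X Y

record NaturalGraceful (ε m : ℕ) (L : List ℕ) : Set where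
  field
    p q          : ℕ
    others       : List (List ℕ)
    pathℕ        : List ℕ
    cycleLengths : map length others ↭ L
    pathLength   : length pathℕ ≡ suc m
    vertexSet    : p ∷ q ∷ concat others ++ pathℕ ↭ upTo (suc ε)
    twoCycle     : q ≡ p + 3 ⊎ p ≡ q + 3
    differences  : ∀ k → 0 < k → k ≤ ε → k ≢ 2 →
      HasDifference (cycleEdges (p ∷ q ∷ []) ++ concatMap cycleEdges others ++ pathEdges pathℕ) k
    εOnPath      : HasDifference (pathEdges pathℕ) ε

module FromLabeling {L m} (Γ : Labeling (2 ∷ L) m)
  (vertices↭ : vertices Γ ↭ I 0 (edgeCount (2 ∷ L) m))
  (Δ↭ : ΔΓ Γ ↭ pm (+ 1 ∷ + 3 ∷ + 3 ∷ []) ++ pm (I 4 (edgeCount (2 ∷ L) m))) where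

  ε : ℕ
  ε = edgeCount (2 ∷ L) m

  natural-vertex : ∀ {v} → v ∈ vertices Γ → Natural v × ∣ v ∣ ≤ ε
  natural-vertex v∈ = ∈-I⇒natural (∈-resp-↭ vertices↭ v∈)

  natural-edge : ∀ {v w} → (v , w) ∈ edges Γ → Natural v × Natural w
  natural-edge e = Prod.map (proj₁ ∘ natural-vertex) (proj₁ ∘ natural-vertex) (∈-edges-endpoints (cycles Γ) (path Γ) e)

  module _ {x y othersℤ} (cycles↭ : cycles Γ ↭ (x ∷ y ∷ []) ∷ othersℤ) where

    private
      restℤ : List (ℤ × ℤ)
      restℤ = concatMap cycleEdges othersℤ ++ pathEdges (path Γ)

      edges↭ : edges Γ ↭ (x , y) ∷ (y , x) ∷ restℤ
      edges↭ = ++⁺ʳ (pathEdges (path Γ)) (concatMap⁺ cycleEdges cycles↭)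

      x-natural : Natural x
      x-natural = proj₁ (natural-edge (∈-resp-↭ (↭-sym edges↭) (here refl)))

      y-natural : Natural y
      y-natural = proj₂ (natural-edge (∈-resp-↭ (↭-sym edges↭) (here refl)))

    natural-vertexSet : ∣ x ∣ ∷ ∣ y ∣ ∷ concat (map (map ∣_∣) othersℤ) ++ map ∣_∣ (path Γ) ↭ upTo (suc ε)
    natural-vertexSet = begin
      ∣ x ∣ ∷ ∣ y ∣ ∷ concat (map (map ∣_∣) othersℤ) ++ map ∣_∣ (path Γ)  ≡⟨ cong (λ vs → ∣ x ∣ ∷ ∣ y ∣ ∷ vs ++ map ∣_∣ (path Γ)) (concat-map othersℤ) ⟩
      ∣ x ∣ ∷ ∣ y ∣ ∷ map ∣_∣ (concat othersℤ) ++ map ∣_∣ (path Γ)        ≡⟨ cong (λ vs → ∣ x ∣ ∷ ∣ y ∣ ∷ vs) (map-++ ∣_∣ (concat othersℤ) (path Γ)) ⟨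
      map ∣_∣ ((x ∷ y ∷ concat othersℤ) ++ path Γ)                         ↭⟨ map⁺ ∣_∣ (++⁺ʳ (path Γ) (concat⁺ (↭-sym cycles↭))) ⟩
      map ∣_∣ (vertices Γ)                                                 ↭⟨ map⁺ ∣_∣ vertices↭ ⟩
      map ∣_∣ (I 0 ε)                                                      ≡⟨ map-∣∣-I ε ⟩
      upTo (suc ε)                                                         ∎
      where open PermutationReasoning

    natural-twoCycle : ∣ y ∣ ≡ ∣ x ∣ + 3 ⊎ ∣ x ∣ ≡ ∣ y ∣ + 3
    natural-twoCycle with double-difference ε (y ℤ.- x) (x ℤ.- y ∷ x ℤ.- y ∷ Δℤ restℤ)
      (↭-trans (↭-shift (x ℤ.- y) (y ℤ.- x ∷ y ℤ.- x ∷ []) (x ℤ.- y ∷ Δℤ restℤ)) (↭-trans (↭-sym (concatMap⁺ _ edges↭)) Δ↭))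
    ... | inj₁ y-x≡3  = inj₁ (minus≡⇒≡+ ∣ y ∣ ∣ x ∣ 3 (trans (cong₂ ℤ._-_ (sym y-natural) (sym x-natural)) y-x≡3))
    ... | inj₂ y-x≡-3 = inj₂ (minus≡⇒≡+ ∣ x ∣ ∣ y ∣ 3 (trans (minus-swap ∣ x ∣ ∣ y ∣)
                          (cong -_ (trans (cong₂ ℤ._-_ (sym y-natural) (sym x-natural)) y-x≡-3))))

    natural-differences : ∀ k → 0 < k → k ≤ ε → k ≢ 2 →
      HasDifference (cycleEdges (∣ x ∣ ∷ ∣ y ∣ ∷ []) ++ concatMap cycleEdges (map (map ∣_∣) othersℤ) ++ pathEdges (map ∣_∣ (path Γ))) k
    natural-differences k 0<k k≤ε k≢2 = subst (λ es → HasDifference es k) edges≡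
      (∈-Δℤ⇒HasDifference ((x , y) ∷ (y , x) ∷ restℤ) (natural-edge ∘ ∈-resp-↭ (↭-sym edges↭))
        (∈-resp-↭ (concatMap⁺ _ edges↭) (∈-resp-↭ (↭-sym Δ↭) (∈-spectrum ε k 0<k k≤ε k≢2))))
      where
      edges≡ : map (Prod.map ∣_∣ ∣_∣) ((x , y) ∷ (y , x) ∷ restℤ)
             ≡ cycleEdges (∣ x ∣ ∷ ∣ y ∣ ∷ []) ++ concatMap cycleEdges (map (map ∣_∣) othersℤ) ++ pathEdges (map ∣_∣ (path Γ))
      edges≡ = cong (λ es → (∣ x ∣ , ∣ y ∣) ∷ (∣ y ∣ , ∣ x ∣) ∷ es)
        (trans (map-++ _ (concatMap cycleEdges othersℤ) _) (cong₂ _++_ (concatMap-cycleEdges-map ∣_∣ othersℤ) (sym (pathEdges-map ∣_∣ (path Γ)))))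

  naturalGraceful : + ε ∈ Δp Γ → NaturalGraceful ε m L
  naturalGraceful ε∈Δp with extract-2-cycle (cycles Γ) L (cycleLen Γ)
  ... | x , y , othersℤ , cycles↭ , lengths = record
    { p            = ∣ x ∣
    ; q            = ∣ y ∣
    ; others       = map (map ∣_∣) othersℤ
    ; pathℕ        = map ∣_∣ (path Γ)
    ; cycleLengths = ↭-trans (↭-reflexive (map-length-map ∣_∣ othersℤ)) lengths
    ; pathLength   = trans (length-map ∣_∣ (path Γ)) (pathLen Γ)
    ; vertexSet    = natural-vertexSet cycles↭
    ; twoCycle     = natural-twoCycle cycles↭
    ; differences  = natural-differences cycles↭
    ; εOnPath      = subst (λ es → HasDifference es ε) (sym (pathEdges-map ∣_∣ (path Γ)))
        (∈-Δℤ⇒HasDifference (pathEdges (path Γ)) (natural-edge ∘ ∈-++⁺ʳ (concatMap cycleEdges (cycles Γ))) ε∈Δp)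
    }

two-cycle-normal : ∀ p q → q ≡ p + 3 ⊎ p ≡ q + 3 →
  ∃ λ u → (p ∷ q ∷ [] ↭ u ∷ u + 3 ∷ []) × (cycleEdges (p ∷ q ∷ []) ↭ cycleEdges (u ∷ u + 3 ∷ []))
two-cycle-normal p .(p + 3) (inj₁ refl) = p , ↭-refl , ↭-refl
two-cycle-normal .(q + 3) q (inj₂ refl) = q , ↭-swap (q + 3) q ↭-refl , ↭-swap (q + 3 , q) (q , q + 3) ↭-refl

module _ {ε m L} (G : NaturalGraceful ε m L) where

  open NaturalGraceful G

  private
    path-vertex≤ε : ∀ {v} → v ∈ pathℕ → v ≤ ε
    path-vertex≤ε v∈ = ℕ.s≤s⁻¹ (∈-upTo⁻ (∈-resp-↭ vertexSet (there (there (∈-++⁺ʳ (concat others) v∈)))))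

    path-edge-0ε : Adjacent (pathEdges pathℕ) 0 ε
    path-edge-0ε with εOnPath
    ... | a , b , a≡b+ε , adj = Sum.swap (subst₂ (Adjacent (pathEdges pathℕ)) a≡ε b≡0 adj)
      where
      a≤ε : a ≤ ε
      a≤ε = path-vertex≤ε (Sum.[ proj₁ ∘ ∈-pathEdges-endpoints pathℕ , proj₂ ∘ ∈-pathEdges-endpoints pathℕ ] adj)
      b≡0 : b ≡ 0
      b≡0 = n≤0⇒n≡0 (+-cancelʳ-≤ ε b 0 (subst (_≤ ε) a≡b+ε a≤ε))
      a≡ε : a ≡ ε
      a≡ε = trans a≡b+ε (cong (_+ ε) b≡0)

  normalise : NormalForm ε m L
  normalise with two-cycle-normal p q twoCycle | ∃-orientation pathℕ path-edge-0ε
  ... | u , two↭ , twoEdges↭ | F , B , oriented = record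
    { u            = u
    ; longCycles   = others
    ; front        = F
    ; back         = B
    ; cycleLengths = cycleLengths
    ; vertexSet    = ↭-trans (++⁺ (↭-sym two↭) (++⁺ˡ (concat others) path↭)) vertexSet
    ; pathLength   = suc-injective (trans (sym length-F0εB) (trans length≡ pathLength))
    ; differences  = λ k 0<k k≤ε k≢2 → HasDifference-map
        (Adjacent-++⁺ʳ (cycleEdges (u ∷ u + 3 ∷ [])) (Adjacent-++⁺ʳ (concatMap cycleEdges others) adjacent)
         ∘ Adjacent-resp-↭ (++⁺ʳ _ twoEdges↭))
        (differences k 0<k k≤ε k≢2)
    }
    where
    path↭ = proj₁ (path-or-reverse oriented)
    length≡ = proj₁ (proj₂ (path-or-reverse oriented))
    adjacent = proj₂ (proj₂ (path-or-reverse oriented))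
    length-F0εB : length (F ++ 0 ∷ ε ∷ B) ≡ suc (suc (length F + length B))
    length-F0εB = trans (length-++ F) (trans (+-suc (length F) _) (cong suc (+-suc (length F) (length B))))

theorem2p13 : (L : List ℕ) (m : ℕ) → All (2 <_) L →
    (Γ : Labeling (2 ∷ L) m) → Graceful (2 ∷ L) m Γ →
    + (edgeCount (2 ∷ L) m) ∈ Δp Γ →
    ∃[ n ] ∃[ Σ' ] (Is2Starter n Σ' × HasType Σ' (2 * m + 7) (4 ∷ L ++ L))
theorem2p13 L m allL Γ (_ , inj₁ (2∉L , _)) _ = ⊥-elim (2∉L (here refl))
theorem2p13 L m allL Γ (vertices↭ , inj₂ (_ , Δ↭)) ε∈Δp = _ , starter , starter-is-2-starter , starter-type
  where open Starter allL (normalise (FromLabeling.naturalGraceful Γ vertices↭ Δ↭ ε∈Δp))
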